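{- Let $A,B$ be finite alphabets with $|A|=n$, $\phi\colon A^*\to A^*$ a $k$-uniform morphism, $h\colon A\to B$ a coding and $s\in A$ such that $\phi$ is prolongable on $s$, and assume every symbol of $A$ occurs in $\phi^\infty(s)$. For $m\in\mathbb{N}$ let $b\sim_m c$ iff $h(\phi^m(b))=h(\phi^m(c))$. Then for every $r\ge B_n$: $h(\phi^\infty(s))$ is almost periodic if and only if there exists $m\in\mathbb{N}$ such that for every $b\in A$ the word $\phi^m(b)$ contains some symbol that is $\sim_r$-equivalent to $s$.
   Context: A morphism satisfies $\phi(uv)=\phi(u)\phi(v)$; it is $k$-uniform if $|\phi(a)|=k$ for all $a\in A$. A coding is a letter-to-letter map $h\colon A\to B$ extended letterwise. $\phi$ is prolongable on $s$ if $s$ is the first letter of $\phi(s)$ and $\phi^\infty(s)=\lim_m\phi^m(s)$ is infinite. $B_n$ is the Bell number (number of equivalence relations on an $n$-element set). A sequence $x$ is almost periodic if for every factor $u$ of $x$ there is $l$ such that every factor of $x$ of length $l$ contains an occurrence of $u$. -}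

module Defs where

open import Data.Nat using (ℕ; zero; suc; _+_; _*_; _<_)
open import Data.Fin using (Fin; fromℕ<)
open import Data.List using (List; []; _∷_; concatMap; applyUpTo; length; lookup; map)
open import Data.List.Relation.Binary.Infix.Heterogeneous using (Infix)
open import Data.List.Membership.Propositional using (_∈_)
open import Data.Product using (Σ; ∃; _×_)
open import Relation.Binary.PropositionalEquality using (_≡_)

-- Stirling numbers of the second kind and Bell numbers:
-- B n = Σ_{j ≤ n} S(n , j) = number of equivalence relations on an n-element set.
stirling2 : ℕ → ℕ → ℕ
stirling2 zero    zero    = 1
stirling2 zero    (suc j) = 0
stirling2 (suc n) zero    = 0
stirling2 (suc n) (suc j) = suc j * stirling2 n (suc j) + stirling2 n j

bellAux : ℕ → ℕ → ℕ
bellAux n zero    = stirling2 n zero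
bellAux n (suc j) = bellAux n j + stirling2 n (suc j)

bell : ℕ → ℕ
bell n = bellAux n n

-- A morphism A* → A* is determined by its images of letters.
Morphism : Set → Set
Morphism A = A → List A

ext : {A : Set} → Morphism A → List A → List A
ext φ = concatMap φ

iter : {A : Set} → Morphism A → ℕ → List A → List A
iter φ zero    w = w
iter φ (suc m) w = ext φ (iter φ m w)

pow : {A : Set} → Morphism A → ℕ → A → List A
pow φ m a = iter φ m (a ∷ [])

Uniform : {A : Set} → ℕ → Morphism A → Set
Uniform k φ = ∀ a → length (φ a) ≡ k

-- φ is prolongable on s: s is the first letter of φ(s) and the words φ^m(s)
-- grow unboundedly (so that φ^∞(s) is infinite)
Prolongable : {A : Set} → Morphism A → A → Set
Prolongable φ s =
  (Σ (List _) λ w → φ s ≡ s ∷ w) × (∀ N → ∃ λ m → N < length (pow φ m s))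

-- x is the infinite word φ^∞(s) = lim φ^m(s): every φ^m(s) is a prefix of x
IsFixedPointLimit : {A : Set} → Morphism A → A → (ℕ → A) → Set
IsFixedPointLimit φ s x =
  ∀ m i (p : i < length (pow φ m s)) → x i ≡ lookup (pow φ m s) (fromℕ< p)

factor : {B : Set} → (ℕ → B) → ℕ → ℕ → List B
factor y i l = applyUpTo (λ q → y (i + q)) l

OccursIn : {B : Set} → List B → List B → Set
OccursIn u w = Infix _≡_ u w

IsFactor : {B : Set} → List B → (ℕ → B) → Set
IsFactor u y = ∃ λ i → u ≡ factor y i (length u)

AlmostPeriodic : {B : Set} → (ℕ → B) → Set
AlmostPeriodic y =
  ∀ u → IsFactor u y → ∃ λ l → ∀ j → OccursIn u (factor y j l)

Equiv : {A B : Set} → Morphism A → (A → B) → ℕ → A → A → Set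
Equiv φ h m b c = map h (pow φ m b) ≡ map h (pow φ m c)

-- The fixed point x = φ^∞(s) is the concatenation of the blocks φᵃ(x t), the t-th one
-- starting at t kᵃ. Since ∼ₜ₊₁ relates b and c iff φ(b) and φ(c) are letterwise ∼ₜ-related,
-- and there are Bell(n) equivalence relations on n letters, the sequence ∼ₜ is periodic
-- from t = Bell(n) on. So if every φᵐ(b) contains a letter c ∼ᵣ s, then for M ≥ r with
-- ∼ᴹ = ∼ᵣ every block φᴹ⁺ᵐ(x t) contains h(φᴹ(c)) = h(φᴹ(s)), a prefix of y = h(x) that
-- can be made as long as needed; as every window of length 2 k^(M+m) contains a whole
-- block, y is almost periodic.
--
-- Conversely, if y is almost periodic, the residues mod L = kʳ of the positions where a
-- long prefix of y recurs stabilise (classically) into a subgroup of ℤ/L, so the prefix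
-- h(φʳ(s)) of length L also recurs at multiples of L, with bounded gaps G. A multiple t L
-- inside the block of φᵐ(b) with kᵐ > G gives a letter x t ∈ φᵐ(b) with x t ∼ᵣ s. Only
-- the existence of G is classical, so the argument is run under double negation and
-- concluded at the fixed exponent (2ⁿ)ⁿ, from which on the letter sets of φᵐ(b) are
-- periodic: there the condition is decidable, hence stable.

module Submission where

open import Defs
open import Data.Nat.Base using (ℕ; zero; suc; _+_; _*_; _^_; _∸_; _≤_; _<_; _≥_; z≤n; s≤s; NonZero; >-nonZero)
open import Data.Nat.DivMod using (_/_; _%_; m≡m%n+[m/n]*n; m%n<n; m/n*n≤m; m*n%n≡0; %-distribˡ-+)
open import Data.Nat.Properties
open import Data.Fin.Base using (Fin; zero; suc; fromℕ<; toℕ; funToFin; finToFun)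
open import Data.Fin.Properties using (pigeonhole; toℕ<n; finToFun-funToFin; all?) renaming (_≟_ to _≟ᶠ_)
open import Data.List.Base using (List; []; _∷_; _++_; length; map; concat; concatMap; applyUpTo; upTo; lookup; allFin)
open import Data.List.Properties
  using (length-++; length-map; length-upTo; length-tabulate; ∷-injective; ++-identityʳ; map-∘; map-cong-local;
         concatMap-pure; map-concatMap; ≡-dec)
open import Data.List.Effectful using (module MonadProperties)
open import Data.List.Membership.Propositional using (_∈_; _∉_; find; lose)
open import Data.List.Membership.Propositional.Properties
  using (∈-concatMap⁺; ∈-concatMap⁻; ∈-map⁺; ∈-++⁺ˡ; ∈-++⁺ʳ; ∈-upTo⁺; ∈-allFin)
open import Data.List.Relation.Unary.All as All using ()
open import Data.List.Relation.Unary.Any as Any using (Any; here; there; any?)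
open import Data.List.Relation.Unary.Any.Properties using (lookup-index)
open import Data.List.Relation.Binary.Pointwise as Pw using (Pointwise; []; _∷_; ≡⇒Pointwise-≡; Pointwise-≡⇒≡)
open import Data.List.Relation.Binary.Infix.Heterogeneous as Infix using (_++ⁱ_; _ⁱ++_; MkView; toView)
open import Data.List.Relation.Binary.Infix.Heterogeneous.Properties as Infixₚ using (fromPointwise)
open import Data.Product.Base using (∃; ∃₂; _×_; _,_; proj₁; proj₂)
open import Data.Sum.Base using (inj₁; inj₂)
open import Effect.Monad using (RawMonad)
open import Function.Base using (_∘_; id; case_of_)
open import Function.Bundles using (_⇔_; mk⇔; Equivalence)
open import Level using (0ℓ)
open import Relation.Binary.Core using () renaming (_⇔_ to _⇔ᴿ_; _⇒_ to _⇒ᴿ_)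
open import Relation.Binary.Definitions using (DecidableEquality)
open import Relation.Binary.PropositionalEquality
  using (_≡_; refl; sym; trans; cong; cong₂; subst; subst₂; module ≡-Reasoning)
open import Relation.Nullary using (¬_; Dec; yes; no; contradiction)
open import Relation.Nullary.Decidable using (¬¬-excluded-middle; map′; decidable-stable)
open import Relation.Nullary.Negation using (¬¬-map; ¬¬-Monad)
open import Relation.Unary using (Decidable)

open RawMonad (¬¬-Monad {0ℓ}) using (pure; _>>=_)

private variable
  A B : Set

++-injective : (xs xs′ : List A) {ys ys′ : List A} → length xs ≡ length xs′ →
               xs ++ ys ≡ xs′ ++ ys′ → xs ≡ xs′ × ys ≡ ys′
++-injective []       []        _   eq = refl , eq
++-injective (x ∷ xs) (x′ ∷ xs′) len eq with ∷-injective eq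
... | refl , eq′ = let xs≡ , ys≡ = ++-injective xs xs′ (suc-injective len) eq′ in cong (x ∷_) xs≡ , ys≡

length-concatMap : ∀ {k} (f : A → List B) → (∀ a → length (f a) ≡ k) →
                   ∀ xs → length (concatMap f xs) ≡ length xs * k
length-concatMap f len []       = refl
length-concatMap f len (x ∷ xs) =
  trans (length-++ (f x)) (cong₂ _+_ (len x) (length-concatMap f len xs))

concatMap-≡⇒Pointwise : ∀ {K} (f : A → List B) → (∀ a → length (f a) ≡ K) →
                        ∀ {xs ys} → length xs ≡ length ys → concatMap f xs ≡ concatMap f ys →
                        Pointwise (λ a b → f a ≡ f b) xs ys
concatMap-≡⇒Pointwise f len {[]}     {[]}     _   _  = []
concatMap-≡⇒Pointwise f len {x ∷ xs} {y ∷ ys} |≡| eq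
  with ++-injective (f x) (f y) (trans (len x) (sym (len y))) eq
... | fx≡fy , rest = fx≡fy ∷ concatMap-≡⇒Pointwise f len (suc-injective |≡|) rest

Pointwise⇒concatMap-≡ : (f : A → List B) {xs ys : List A} →
                        Pointwise (λ a b → f a ≡ f b) xs ys → concatMap f xs ≡ concatMap f ys
Pointwise⇒concatMap-≡ f pw = cong concat (Pointwise-≡⇒≡ (Pw.map⁺ f f pw))

map-≡⇒≡ : {f g : A → B} {xs : List A} → map f xs ≡ map g xs → ∀ {a} → a ∈ xs → f a ≡ g a
map-≡⇒≡ {xs = x ∷ xs} eq (here refl)  = proj₁ (∷-injective eq)
map-≡⇒≡ {xs = x ∷ xs} eq (there a∈xs) = map-≡⇒≡ (proj₂ (∷-injective eq)) a∈xs

occursIn-refl : (u : List A) → OccursIn u u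
occursIn-refl u = fromPointwise (≡⇒Pointwise-≡ refl)

occursIn-++ : (p u q : List A) → OccursIn u (p ++ u ++ q)
occursIn-++ p u q = p ++ⁱ (occursIn-refl u ⁱ++ q)

occursIn⇒++ : {u w : List A} → OccursIn u w → ∃₂ λ p q → w ≡ p ++ u ++ q
occursIn⇒++ o with toView o
... | MkView p eq q = p , q , cong (λ v → p ++ v ++ q) (sym (Pointwise-≡⇒≡ eq))

occursIn-concatMap : (f : A → List B) {x : A} {xs : List A} → x ∈ xs →
                     OccursIn (f x) (concatMap f xs)
occursIn-concatMap f {xs = x ∷ xs} (here refl)   = occursIn-refl (f x) ⁱ++ concatMap f xs
occursIn-concatMap f {xs = y ∷ xs} (there x∈xs) = f y ++ⁱ occursIn-concatMap f x∈xs

occursIn-trans : {u v w : List A} → OccursIn u v → OccursIn v w → OccursIn u w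
occursIn-trans = Infixₚ.trans trans

occursIn-map : (f : A → B) {u w : List A} → OccursIn u w → OccursIn (map f u) (map f w)
occursIn-map f o = Infixₚ.map⁺ f f (Infix.map (cong f) o)

slice : (ℕ → A) → ℕ → ℕ → List A
slice z i zero    = []
slice z i (suc l) = z i ∷ slice z (suc i) l

length-slice : (z : ℕ → A) (i l : ℕ) → length (slice z i l) ≡ l
length-slice z i zero    = refl
length-slice z i (suc l) = cong suc (length-slice z (suc i) l)

map-slice : (f : A → B) (z : ℕ → A) (i l : ℕ) → map f (slice z i l) ≡ slice (f ∘ z) i l
map-slice f z i zero    = refl
map-slice f z i (suc l) = cong (f (z i) ∷_) (map-slice f z (suc i) l)

slice-++ : (z : ℕ → A) (i a b : ℕ) → slice z i (a + b) ≡ slice z i a ++ slice z (i + a) b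
slice-++ z i zero    b = cong (λ j → slice z j b) (sym (+-identityʳ i))
slice-++ z i (suc a) b = cong (z i ∷_)
  (trans (slice-++ z (suc i) a b) (cong (λ j → slice z (suc i) a ++ slice z j b) (sym (+-suc i a))))

slice-≡ : {z z′ : ℕ → A} {i j : ℕ} (l : ℕ) → (∀ d → d < l → z (i + d) ≡ z′ (j + d)) →
          slice z i l ≡ slice z′ j l
slice-≡ zero    eq = refl
slice-≡ {z = z} {z′} {i} {j} (suc l) eq = cong₂ _∷_
  (trans (cong z (sym (+-identityʳ i))) (trans (eq 0 (s≤s z≤n)) (cong z′ (+-identityʳ j))))
  (slice-≡ l λ d d<l → trans (cong z (sym (+-suc i d))) (trans (eq (suc d) (s≤s d<l)) (cong z′ (+-suc j d))))

slice-≡⁻ : {z z′ : ℕ → A} {i j : ℕ} (l : ℕ) → slice z i l ≡ slice z′ j l →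
           ∀ d → d < l → z (i + d) ≡ z′ (j + d)
slice-≡⁻ {z = z} {z′} {i} {j} (suc l) eq zero    _ =
  trans (cong z (+-identityʳ i)) (trans (proj₁ (∷-injective eq)) (cong z′ (sym (+-identityʳ j))))
slice-≡⁻ {z = z} {z′} {i} {j} (suc l) eq (suc d) (s≤s d<l) =
  trans (cong z (+-suc i d)) (trans (slice-≡⁻ l (proj₂ (∷-injective eq)) d d<l) (cong z′ (sym (+-suc j d))))

applyUpTo≡slice : (f z : ℕ → A) (i l : ℕ) → (∀ q → f q ≡ z (i + q)) → applyUpTo f l ≡ slice z i l
applyUpTo≡slice f z i zero    eq = refl
applyUpTo≡slice f z i (suc l) eq = cong₂ _∷_ (trans (eq 0) (cong z (+-identityʳ i)))
  (applyUpTo≡slice (f ∘ suc) z (suc i) l λ q → trans (eq (suc q)) (cong z (+-suc i q)))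

factor≡slice : (z : ℕ → A) (i l : ℕ) → factor z i l ≡ slice z i l
factor≡slice z i l = applyUpTo≡slice _ z i l λ q → refl

∈-slice : (z : ℕ → A) (i : ℕ) {d l : ℕ} → d < l → z (i + d) ∈ slice z i l
∈-slice z i {zero}  {suc l} _         = here (cong z (+-identityʳ i))
∈-slice z i {suc d} {suc l} (s≤s d<l) = there (subst (_∈ slice z (suc i) l) (cong z (sym (+-suc i d))) (∈-slice z (suc i) d<l))

slice-++-++ : (z : ℕ → A) (i a b c : ℕ) →
              slice z i (a + (b + c)) ≡ slice z i a ++ slice z (i + a) b ++ slice z (i + a + b) c
slice-++-++ z i a b c = trans (slice-++ z i a (b + c)) (cong (slice z i a ++_) (slice-++ z (i + a) b c))

slice-occursIn : (z : ℕ → A) (i l d V : ℕ) → d + V ≤ l → OccursIn (slice z (i + d) V) (slice z i l)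
slice-occursIn z i l d V d+V≤l with m≤n⇒∃[o]m+o≡n d+V≤l
... | e , refl = subst (OccursIn _) (sym (trans (cong (slice z i) (+-assoc d V e)) (slice-++-++ z i d V e)))
                   (occursIn-++ (slice z i d) _ (slice z (i + d + V) e))

occursIn-slice : (z : ℕ → A) (i l : ℕ) {u : List A} → OccursIn u (slice z i l) →
                 ∃ λ d → d + length u ≤ l × u ≡ slice z (i + d) (length u)
occursIn-slice z i l {u} o with occursIn⇒++ o
... | p , q , eq = length p , ≤-trans (+-monoʳ-≤ (length p) (m≤m+n (length u) (length q))) (≤-reflexive |puq|≡l) ,
    proj₁ (++-injective u (slice z (i + length p) (length u)) (sym (length-slice z _ _))
            (proj₂ (++-injective p (slice z i (length p)) (sym (length-slice z i _))
              (trans (sym eq) (trans (cong (slice z i) (sym |puq|≡l)) (slice-++-++ z i (length p) (length u) (length q)))))))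
  where
  |puq|≡l : length p + (length u + length q) ≡ l
  |puq|≡l = begin
    length p + (length u + length q)  ≡⟨ cong (length p +_) (sym (length-++ u)) ⟩
    length p + length (u ++ q)        ≡⟨ sym (length-++ p) ⟩
    length (p ++ u ++ q)              ≡⟨ cong length (sym eq) ⟩
    length (slice z i l)              ≡⟨ length-slice z i l ⟩
    l                                 ∎
    where open ≡-Reasoning

concatMap-slice : ∀ {K} {f : A → List B} → (∀ a → length (f a) ≡ K) → (x : ℕ → A) (z : ℕ → B) →
                  ∀ T i j → concatMap f (slice x i T) ≡ slice z j (T * K) →
                  ∀ t → t < T → f (x (i + t)) ≡ slice z (j + t * K) K
concatMap-slice {K = K} {f} len x z (suc T) i j eq t t<T
  with ++-injective (f (x i)) (slice z j K) (trans (len (x i)) (sym (length-slice z j K)))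
         (trans eq (slice-++ z j K (T * K)))
... | head , tail with t | t<T
... | zero  | _ = subst₂ (λ a b → f (x a) ≡ slice z b K) (sym (+-identityʳ i)) (sym (+-identityʳ j)) head
... | suc t | s≤s t<T = subst₂ (λ a b → f (x a) ≡ slice z b K) (sym (+-suc i t)) (+-assoc j K (t * K))
        (concatMap-slice len x z T (suc i) (j + K) tail t t<T)

lookup≡⇒≡slice : (z : ℕ → A) (i : ℕ) (w : List A) →
                 (∀ d (d<|w| : d < length w) → lookup w (fromℕ< d<|w|) ≡ z (i + d)) → w ≡ slice z i (length w)
lookup≡⇒≡slice z i []      eq = refl
lookup≡⇒≡slice z i (a ∷ w) eq = cong₂ _∷_ (trans (eq 0 (s≤s z≤n)) (cong z (+-identityʳ i)))
  (lookup≡⇒≡slice z (suc i) w λ d d<|w| → trans (eq (suc d) (s≤s d<|w|)) (cong z (+-suc i d)))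

module _ (φ : Morphism A) where

  iter-+ : ∀ a b w → iter φ (a + b) w ≡ iter φ a (iter φ b w)
  iter-+ zero    b w = refl
  iter-+ (suc a) b w = cong (ext φ) (iter-+ a b w)

  iter≡concatMap-pow : ∀ m w → iter φ m w ≡ concatMap (pow φ m) w
  iter≡concatMap-pow zero    w = sym (concatMap-pure w)
  iter≡concatMap-pow (suc m) w = begin
    concatMap φ (iter φ m w)                        ≡⟨ cong (concatMap φ) (iter≡concatMap-pow m w) ⟩
    concatMap φ (concatMap (pow φ m) w)             ≡⟨ sym (MonadProperties.associative w (pow φ m) φ) ⟩
    concatMap (λ c → concatMap φ (pow φ m c)) w     ∎
    where open ≡-Reasoning

  pow-+ : ∀ a b c → pow φ (a + b) c ≡ concatMap (pow φ a) (pow φ b c)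
  pow-+ a b c = trans (iter-+ a b (c ∷ [])) (iter≡concatMap-pow a (pow φ b c))

  pow-suc : ∀ t c → pow φ (suc t) c ≡ concatMap (pow φ t) (φ c)
  pow-suc t c = begin
    pow φ (suc t) c                       ≡⟨ cong (λ m → pow φ m c) (+-comm 1 t) ⟩
    pow φ (t + 1) c                       ≡⟨ pow-+ t 1 c ⟩
    concatMap (pow φ t) (φ c ++ [])       ≡⟨ cong (concatMap (pow φ t)) (++-identityʳ (φ c)) ⟩
    concatMap (pow φ t) (φ c)             ∎
    where open ≡-Reasoning

  length-pow : ∀ {k} → Uniform k φ → ∀ m c → length (pow φ m c) ≡ k ^ m
  length-pow uniform zero    c = refl
  length-pow {k = k} uniform (suc m) c = begin
    length (concatMap φ (pow φ m c))  ≡⟨ length-concatMap φ uniform (pow φ m c) ⟩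
    length (pow φ m c) * k            ≡⟨ cong (_* k) (length-pow uniform m c) ⟩
    k ^ m * k                         ≡⟨ *-comm (k ^ m) k ⟩
    k ^ suc m                         ∎
    where open ≡-Reasoning

  ∈-pow-suc : ∀ t {a b} → a ∈ pow φ (suc t) b ⇔ Any (λ c → a ∈ pow φ t c) (φ b)
  ∈-pow-suc t {a} {b} = mk⇔
    (λ a∈ → ∈-concatMap⁻ (pow φ t) (subst (a ∈_) (pow-suc t b) a∈))
    (λ a∈ → subst (a ∈_) (sym (pow-suc t b)) (∈-concatMap⁺ (pow φ t) a∈))

  Equiv-suc : ∀ {k} → Uniform k φ → (h : A → B) → ∀ t {b c} →
              Equiv φ h (suc t) b c ⇔ Pointwise (Equiv φ h t) (φ b) (φ c)
  Equiv-suc {B = B} {k = k} uniform h t {b} {c} = mk⇔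
    (λ eq → concatMap-≡⇒Pointwise hpow length-hpow (trans (uniform b) (sym (uniform c)))
              (trans (sym (hpow-suc b)) (trans eq (hpow-suc c))))
    (λ pw → trans (hpow-suc b) (trans (Pointwise⇒concatMap-≡ hpow pw) (sym (hpow-suc c))))
    where
    hpow : A → List B
    hpow = map h ∘ pow φ t
    hpow-suc : ∀ a → map h (pow φ (suc t) a) ≡ concatMap hpow (φ a)
    hpow-suc a = trans (cong (map h) (pow-suc t a)) (map-concatMap h (pow φ t) (φ a))
    length-hpow : ∀ a → length (hpow a) ≡ k ^ t
    length-hpow a = trans (length-map h (pow φ t a)) (length-pow uniform t a)

m<k^m : ∀ {k} → 2 ≤ k → ∀ m → m < k ^ m
m<k^m 2≤k zero    = s≤s z≤n
m<k^m {k} 2≤k (suc m) = begin-strict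
  suc m          ≤⟨ m<k^m 2≤k m ⟩
  k ^ m          <⟨ m<m+n (k ^ m) (≤-trans (s≤s z≤n) (m<k^m 2≤k m)) ⟩
  k ^ m + k ^ m  ≡⟨ cong (k ^ m +_) (sym (+-identityʳ (k ^ m))) ⟩
  2 * k ^ m      ≤⟨ *-monoˡ-≤ (k ^ m) 2≤k ⟩
  k ^ suc m      ∎
  where open ≤-Reasoning

multipleBetween : ∀ K .{{_ : NonZero K}} j → ∃ λ t → j ≤ t * K × t * K ≤ j + K
multipleBetween K j = suc (j / K) , j≤ , ≤j+K
  where
  j≤ : j ≤ K + j / K * K
  j≤ = begin
    j                  ≡⟨ m≡m%n+[m/n]*n j K ⟩
    j % K + j / K * K  ≤⟨ +-monoˡ-≤ (j / K * K) (<⇒≤ (m%n<n j K)) ⟩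
    K + j / K * K      ∎
    where open ≤-Reasoning
  ≤j+K : K + j / K * K ≤ j + K
  ≤j+K = ≤-trans (+-monoʳ-≤ K (m/n*n≤m j K)) (≤-reflexive (+-comm K j))

-- Fixed points of uniform morphisms

module FixedPoint {k : ℕ} {φ : Morphism A} (uniform : Uniform k φ) {s : A} (prolongable : Prolongable φ s)
                  {x : ℕ → A} (limit : IsFixedPointLimit φ s x) where

  2≤k : 2 ≤ k
  2≤k with 2 ≤? k
  ... | yes k≥2 = k≥2
  ... | no  2≰k with proj₂ prolongable 1
  ...   | m , 1<|φᵐs| = contradiction 1<|φᵐs| (≤⇒≯ (begin
    length (pow φ m s)  ≡⟨ length-pow φ uniform m s ⟩
    k ^ m               ≤⟨ ^-monoˡ-≤ m (≤-pred (≰⇒> 2≰k)) ⟩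
    1 ^ m               ≡⟨ ^-zeroˡ m ⟩
    1                   ∎))
    where open ≤-Reasoning

  prefix : ∀ N → pow φ N s ≡ slice x 0 (k ^ N)
  prefix N = trans (lookup≡⇒≡slice x 0 (pow φ N s) λ d d< → sym (limit N d d<))
                   (cong (slice x 0) (length-pow φ uniform N s))

  block : ∀ a t → pow φ a (x t) ≡ slice x (t * k ^ a) (k ^ a)
  block a t = concatMap-slice (length-pow φ uniform a) x x (k ^ t) 0 0 (begin
      concatMap (pow φ a) (slice x 0 (k ^ t))   ≡⟨ cong (concatMap (pow φ a)) (sym (prefix t)) ⟩
      concatMap (pow φ a) (pow φ t s)           ≡⟨ sym (pow-+ φ a t s) ⟩
      pow φ (a + t) s                           ≡⟨ prefix (a + t) ⟩
      slice x 0 (k ^ (a + t))                   ≡⟨ cong (slice x 0) (trans (^-distribˡ-+-* k a t) (*-comm (k ^ a) (k ^ t))) ⟩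
      slice x 0 (k ^ t * k ^ a)                 ∎)
    t (m<k^m 2≤k t)
    where open ≡-Reasoning

  kᵐ≢0 : ∀ m → NonZero (k ^ m)
  kᵐ≢0 m = >-nonZero (≤-trans (s≤s z≤n) (m<k^m 2≤k m))

  ∈-block : ∀ a t j → j < k ^ a → x (t * k ^ a + j) ∈ pow φ a (x t)
  ∈-block a t j j<kᵃ = subst (x (t * k ^ a + j) ∈_) (sym (block a t)) (∈-slice x (t * k ^ a) j<kᵃ)

-- Eventually periodic families of relations

⇔ᴿ-refl : {R : A → B → Set} → R ⇔ᴿ R
⇔ᴿ-refl = (λ r → r) , (λ r → r)

⇔ᴿ-trans : {R S T : A → B → Set} → R ⇔ᴿ S → S ⇔ᴿ T → R ⇔ᴿ T
⇔ᴿ-trans (R⇒S , S⇒R) (S⇒T , T⇒S) = (λ r → S⇒T (R⇒S r)) , (λ t → S⇒R (T⇒S t))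

eventuallyPeriodic : {P : ℕ → A → B → Set} →
                     (∀ t t′ → P t ⇔ᴿ P t′ → P (suc t) ⇔ᴿ P (suc t′)) →
                     ∀ {N} (code : ℕ → Fin N) → (∀ t t′ → code t ≡ code t′ → P t ⇔ᴿ P t′) →
                     ∃ λ q → 0 < q × ∀ r → N ≤ r → ∀ w → P r ⇔ᴿ P (r + q * w)
eventuallyPeriodic {P = P} step {N} code code-sound
  with pigeonhole (n<1+n N) (code ∘ toℕ)
... | i , j , i<j , code≡ with m≤n⇒∃[o]m+o≡n i<j
... | o , i+q≡j = q , s≤s z≤n , periodic
  where
  q = suc o
  i′ = toℕ i

  shift : ∀ d → P (d + i′) ⇔ᴿ P (d + (i′ + q))
  shift zero    = subst (λ j′ → P i′ ⇔ᴿ P j′) (trans (sym i+q≡j) (sym (+-suc i′ o)))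
                        (code-sound (toℕ i) (toℕ j) code≡)
  shift (suc d) = step (d + i′) (d + (i′ + q)) (shift d)

  period : ∀ r → i′ ≤ r → P r ⇔ᴿ P (r + q)
  period r i′≤r with m≤n⇒∃[o]m+o≡n i′≤r
  ... | e , refl = subst₂ (λ a b → P a ⇔ᴿ P b) (+-comm e i′)
                     (trans (sym (+-assoc e i′ q)) (cong (_+ q) (+-comm e i′))) (shift e)

  i′≤N : i′ ≤ N
  i′≤N = ≤-trans (<⇒≤ i<j) (≤-pred (toℕ<n j))

  periodic : ∀ r → N ≤ r → ∀ w → P r ⇔ᴿ P (r + q * w)
  periodic r N≤r zero    = subst (λ b → P r ⇔ᴿ P b) (sym (trans (cong (r +_) (*-zeroʳ q)) (+-identityʳ r))) ⇔ᴿ-refl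
  periodic r N≤r (suc w) = ⇔ᴿ-trans (periodic r N≤r w)
    (subst (λ b → P (r + q * w) ⇔ᴿ P b) (trans (+-assoc r (q * w) q) (cong (r +_) (trans (+-comm (q * w) q) (sym (*-suc q w)))))
      (period (r + q * w) (≤-trans i′≤N (≤-trans N≤r (m≤m+n r (q * w))))))

-- Counting equivalence relations by restricted growth strings

-- rgs n j lists the words of length n over the labels 0 … j-1 in which, reading from
-- the right, every label first appears after all smaller ones; these encode the
-- partitions of an n-element set into j blocks.
rgs : ℕ → ℕ → List (List ℕ)
rgs zero    zero    = [] ∷ []
rgs zero    (suc j) = []
rgs (suc n) zero    = []
rgs (suc n) (suc j) = concatMap (λ c → map (c ∷_) (rgs n (suc j))) (upTo (suc j)) ++ map (j ∷_) (rgs n j)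

length-rgs : ∀ n j → length (rgs n j) ≡ stirling2 n j
length-rgs zero    zero    = refl
length-rgs zero    (suc j) = refl
length-rgs (suc n) zero    = refl
length-rgs (suc n) (suc j) = begin
  length (concatMap old (upTo (suc j)) ++ map (j ∷_) (rgs n j))
    ≡⟨ length-++ (concatMap old (upTo (suc j))) ⟩
  length (concatMap old (upTo (suc j))) + length (map (j ∷_) (rgs n j))
    ≡⟨ cong₂ _+_ (length-concatMap old (λ c → length-map (c ∷_) (rgs n (suc j))) (upTo (suc j)))
                 (length-map (j ∷_) (rgs n j)) ⟩
  length (upTo (suc j)) * length (rgs n (suc j)) + length (rgs n j)
    ≡⟨ cong₂ _+_ (cong₂ _*_ (length-upTo (suc j)) (length-rgs n (suc j))) (length-rgs n j) ⟩
  stirling2 (suc n) (suc j) ∎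
  where
  open ≡-Reasoning
  old : ℕ → List (List ℕ)
  old c = map (c ∷_) (rgs n (suc j))

∷-∈-rgs-old : ∀ {n j c w} → c < j → w ∈ rgs n j → c ∷ w ∈ rgs (suc n) j
∷-∈-rgs-old {n} {suc j} {c} {w} c<j w∈ =
  ∈-++⁺ˡ (∈-concatMap⁺ (λ c′ → map (c′ ∷_) (rgs n (suc j)))
           (Any.map (λ { refl → ∈-map⁺ (c ∷_) w∈ }) (∈-upTo⁺ c<j)))

∷-∈-rgs-new : ∀ {n j w} → w ∈ rgs n j → j ∷ w ∈ rgs (suc n) (suc j)
∷-∈-rgs-new {n} {j} w∈ = ∈-++⁺ʳ (concatMap (λ c → map (c ∷_) (rgs n (suc j))) (upTo (suc j))) (∈-map⁺ (j ∷_) w∈)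

rgsUpTo : ℕ → ℕ → List (List ℕ)
rgsUpTo n zero    = rgs n zero
rgsUpTo n (suc j) = rgsUpTo n j ++ rgs n (suc j)

length-rgsUpTo : ∀ n j → length (rgsUpTo n j) ≡ bellAux n j
length-rgsUpTo n zero    = length-rgs n zero
length-rgsUpTo n (suc j) = trans (length-++ (rgsUpTo n j)) (cong₂ _+_ (length-rgsUpTo n j) (length-rgs n (suc j)))

∈-rgsUpTo : ∀ {n j J w} → j ≤ J → w ∈ rgs n j → w ∈ rgsUpTo n J
∈-rgsUpTo {J = zero}  z≤n w∈ = w∈
∈-rgsUpTo {j = j} {suc J} j≤J w∈ with m≤n⇒m<n∨m≡n j≤J
... | inj₁ j<J  = ∈-++⁺ˡ (∈-rgsUpTo (≤-pred j<J) w∈)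
... | inj₂ refl = ∈-++⁺ʳ (rgsUpTo _ J) w∈

module Labelling {D : Set} (_≟_ : DecidableEquality D) where

  open import Data.List.Membership.DecPropositional _≟_ using (_∈?_)

  labelIn : D → List D → ℕ
  labelIn d []       = 0
  labelIn d (e ∷ es) with d ≟ e
  ... | yes _ = 0
  ... | no  _ = suc (labelIn d es)

  labelIn-< : ∀ {d R} → d ∈ R → labelIn d R < length R
  labelIn-< {d} {e ∷ es} d∈ with d ≟ e | d∈
  ... | yes _   | _          = s≤s z≤n
  ... | no  d≢e | here d≡e   = contradiction d≡e d≢e
  ... | no  _   | there d∈es = s≤s (labelIn-< d∈es)

  labelIn-++ : ∀ {d} R {R′} → d ∈ R → labelIn d (R ++ R′) ≡ labelIn d R
  labelIn-++ {d} (e ∷ es) d∈ with d ≟ e | d∈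
  ... | yes _   | _          = refl
  ... | no  d≢e | here d≡e   = contradiction d≡e d≢e
  ... | no  _   | there d∈es = cong suc (labelIn-++ es d∈es)

  labelIn-∉ : ∀ {d} R → d ∉ R → labelIn d (R ++ d ∷ []) ≡ length R
  labelIn-∉ {d} [] _ with d ≟ d
  ... | yes _   = refl
  ... | no  d≢d = contradiction refl d≢d
  labelIn-∉ {d} (e ∷ es) d∉ with d ≟ e
  ... | yes d≡e = contradiction (here d≡e) d∉
  ... | no  _   = cong suc (labelIn-∉ es (d∉ ∘ there))

  labelIn-injective : ∀ {d d′ R} → d ∈ R → d′ ∈ R → labelIn d R ≡ labelIn d′ R → d ≡ d′
  labelIn-injective {d} {d′} {e ∷ es} d∈ d′∈ eq with d ≟ e | d′ ≟ e | d∈ | d′∈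
  ... | yes d≡e | yes d′≡e | _ | _ = trans d≡e (sym d′≡e)
  ... | no  d≢e | _        | here d≡e | _ = contradiction d≡e d≢e
  ... | _       | no d′≢e  | _ | here d′≡e = contradiction d′≡e d′≢e
  ... | no  _   | no _     | there d∈es | there d′∈es = labelIn-injective d∈es d′∈es (suc-injective eq)

  -- New entries are appended, so the labels of the entries already present do not change.
  distinct : List D → List D
  distinct []       = []
  distinct (d ∷ ds) with d ∈? distinct ds
  ... | yes _ = distinct ds
  ... | no  _ = distinct ds ++ d ∷ []

  ∈-distinct : ∀ {d v} → d ∈ v → d ∈ distinct v
  ∈-distinct {v = d ∷ ds} d∈ with d ∈? distinct ds | d∈
  ... | yes d∈R | here refl = d∈R
  ... | yes _   | there d∈ds = ∈-distinct d∈ds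
  ... | no  _   | here refl = ∈-++⁺ʳ (distinct ds) (here refl)
  ... | no  _   | there d∈ds = ∈-++⁺ˡ (∈-distinct d∈ds)

  length-distinct : ∀ v → length (distinct v) ≤ length v
  length-distinct []       = z≤n
  length-distinct (d ∷ ds) with d ∈? distinct ds
  ... | yes _ = m≤n⇒m≤1+n (length-distinct ds)
  ... | no  _ = ≤-trans (≤-reflexive (trans (length-++ (distinct ds)) (+-comm _ 1))) (s≤s (length-distinct ds))

  labelling : List D → List ℕ
  labelling v = map (λ d → labelIn d (distinct v)) v

  labelling-∈-rgs : ∀ v → labelling v ∈ rgs (length v) (length (distinct v))
  labelling-∈-rgs []       = here refl
  labelling-∈-rgs (d ∷ ds) with d ∈? distinct ds
  ... | yes d∈R = ∷-∈-rgs-old (labelIn-< d∈R) (labelling-∈-rgs ds)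
  ... | no  d∉R = subst₂ (λ c j → c ∷ map (λ e → labelIn e R′) ds ∈ rgs (suc (length ds)) j)
                    (sym (labelIn-∉ R d∉R)) (sym (trans (length-++ R) (+-comm (length R) 1)))
                    (subst (λ w → length R ∷ w ∈ rgs (suc (length ds)) (suc (length R)))
                       (map-cong-local (All.tabulate λ e∈ → sym (labelIn-++ R (∈-distinct e∈))))
                       (∷-∈-rgs-new {n = length ds} (labelling-∈-rgs ds)))
    where
    R  = distinct ds
    R′ = R ++ d ∷ []

  labelling-∈-rgsUpTo : ∀ v → labelling v ∈ rgsUpTo (length v) (length v)
  labelling-∈-rgsUpTo v = ∈-rgsUpTo (length-distinct v) (labelling-∈-rgs v)

  labelling-kernel : {X : Set} (f g : X → D) {xs : List X} → labelling (map f xs) ≡ labelling (map g xs) →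
                     ∀ {a b} → a ∈ xs → b ∈ xs → f a ≡ f b → g a ≡ g b
  labelling-kernel f g {xs} eq {a} {b} a∈ b∈ fa≡fb =
    labelIn-injective (∈-distinct (∈-map⁺ g a∈)) (∈-distinct (∈-map⁺ g b∈)) (begin
      labelIn (g a) Rg  ≡⟨ sym (same a∈) ⟩
      labelIn (f a) Rf  ≡⟨ cong (λ d → labelIn d Rf) fa≡fb ⟩
      labelIn (f b) Rf  ≡⟨ same b∈ ⟩
      labelIn (g b) Rg  ∎)
    where
    open ≡-Reasoning
    Rf = distinct (map f xs)
    Rg = distinct (map g xs)
    same : ∀ {c} → c ∈ xs → labelIn (f c) Rf ≡ labelIn (g c) Rg
    same = map-≡⇒≡ (trans (map-∘ xs) (trans eq (sym (map-∘ xs))))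

-- Periodicity of ∼ₜ and of the letter sets of φᵗ(b)

Contains : Morphism A → ℕ → A → A → Set
Contains φ t b a = a ∈ pow φ t b

decToFin : {P : Set} → Dec P → Fin 2
decToFin (yes _) = zero
decToFin (no _)  = suc zero

decToFin-≡⇒ : {P Q : Set} (P? : Dec P) (Q? : Dec Q) → decToFin P? ≡ decToFin Q? → P → Q
decToFin-≡⇒ (yes _) (yes q) _ _ = q
decToFin-≡⇒ (no ¬p) _       _ p = contradiction p ¬p

funToFin-injective : ∀ {m n} {f g : Fin m → Fin n} → funToFin f ≡ funToFin g → ∀ i → f i ≡ g i
funToFin-injective {f = f} {g} eq i =
  trans (sym (finToFun-funToFin f i)) (trans (cong (λ c → finToFun c i) eq) (finToFun-funToFin g i))

module _ {n : ℕ} (φ : Morphism (Fin n)) where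

  Contains-eventuallyPeriodic :
    ∃ λ q → 0 < q × ∀ r → (2 ^ n) ^ n ≤ r → ∀ w → Contains φ r ⇔ᴿ Contains φ (r + q * w)
  Contains-eventuallyPeriodic = eventuallyPeriodic {P = Contains φ} step code sound
    where
    open import Data.List.Membership.DecPropositional (_≟ᶠ_ {n}) using (_∈?_)

    step : ∀ t t′ → Contains φ t ⇔ᴿ Contains φ t′ → Contains φ (suc t) ⇔ᴿ Contains φ (suc t′)
    step t t′ (t⇒t′ , t′⇒t) =
      (λ {b} {a} a∈ → Equivalence.from (∈-pow-suc φ t′) (Any.map t⇒t′ (Equivalence.to (∈-pow-suc φ t) a∈))) ,
      (λ {b} {a} a∈ → Equivalence.from (∈-pow-suc φ t) (Any.map t′⇒t (Equivalence.to (∈-pow-suc φ t′) a∈)))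

    code : ℕ → Fin ((2 ^ n) ^ n)
    code t = funToFin λ b → funToFin λ a → decToFin (a ∈? pow φ t b)

    sound : ∀ t t′ → code t ≡ code t′ → Contains φ t ⇔ᴿ Contains φ t′
    sound t t′ eq = (λ {b} {a} → decToFin-≡⇒ _ _ (bits≡ b a)) , (λ {b} {a} → decToFin-≡⇒ _ _ (sym (bits≡ b a)))
      where
      bits≡ : ∀ b a → decToFin (a ∈? pow φ t b) ≡ decToFin (a ∈? pow φ t′ b)
      bits≡ b a = funToFin-injective (funToFin-injective eq b) a

  module _ {k : ℕ} (uniform : Uniform k φ) {B : Set} (_≟_ : DecidableEquality B) (h : Fin n → B) where

    Equiv-eventuallyPeriodic :
      ∃ λ q → 0 < q × ∀ r → bell n ≤ r → ∀ w → Equiv φ h r ⇔ᴿ Equiv φ h (r + q * w)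
    Equiv-eventuallyPeriodic =
      let q , 0<q , periodic = eventuallyPeriodic {P = Equiv φ h} step code sound
      in  q , 0<q , λ r bell≤r → periodic r (subst (_≤ r) (sym (length-rgsUpTo n n)) bell≤r)
      where
      open Labelling (≡-dec _≟_)

      step : ∀ t t′ → Equiv φ h t ⇔ᴿ Equiv φ h t′ → Equiv φ h (suc t) ⇔ᴿ Equiv φ h (suc t′)
      step t t′ (t⇒t′ , t′⇒t) =
        (λ e → Equivalence.from (Equiv-suc φ uniform h t′) (Pw.map t⇒t′ (Equivalence.to (Equiv-suc φ uniform h t) e))) ,
        (λ e → Equivalence.from (Equiv-suc φ uniform h t) (Pw.map t′⇒t (Equivalence.to (Equiv-suc φ uniform h t′) e)))

      kernel : ℕ → List ℕ
      kernel t = labelling (map (map h ∘ pow φ t) (allFin n))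

      kernel-∈ : ∀ t → kernel t ∈ rgsUpTo n n
      kernel-∈ t = subst (λ m → kernel t ∈ rgsUpTo m m) (trans (length-map _ (allFin n)) (length-tabulate {n = n} id))
                     (labelling-∈-rgsUpTo (map (map h ∘ pow φ t) (allFin n)))

      code : ℕ → Fin (length (rgsUpTo n n))
      code t = Any.index (kernel-∈ t)

      sound : ∀ t t′ → code t ≡ code t′ → Equiv φ h t ⇔ᴿ Equiv φ h t′
      sound t t′ eq = imp t t′ kernel≡ , imp t′ t (sym kernel≡)
        where
        kernel≡ : kernel t ≡ kernel t′
        kernel≡ = trans (lookup-index (kernel-∈ t)) (trans (cong (lookup (rgsUpTo n n)) eq) (sym (lookup-index (kernel-∈ t′))))
        imp : ∀ t t′ → kernel t ≡ kernel t′ → Equiv φ h t ⇒ᴿ Equiv φ h t′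
        imp t t′ eq {b} {c} = labelling-kernel (map h ∘ pow φ t) (map h ∘ pow φ t′) eq (∈-allFin b) (∈-allFin c)

-- Finite choices under double negation

module _ {P : ℕ → Set} where

  ¬¬-decidableBelow : ∀ L → ¬ ¬ (∀ ρ → ρ < L → Dec (P ρ))
  ¬¬-decidableBelow zero    = pure λ _ ()
  ¬¬-decidableBelow (suc L) = do
    below ← ¬¬-decidableBelow L
    P? ← ¬¬-excluded-middle
    pure (extend below P?)
    where
    extend : (∀ ρ → ρ < L → Dec (P ρ)) → Dec (P L) → ∀ ρ → ρ < suc L → Dec (P ρ)
    extend below P? ρ ρ<1+L with m≤n⇒m<n∨m≡n (≤-pred ρ<1+L)
    ... | inj₁ ρ<L  = below ρ ρ<L
    ... | inj₂ refl = P?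

  ¬¬-decidable : ∀ {L} → (∀ {ρ} → P ρ → ρ < L) → ¬ ¬ Decidable P
  ¬¬-decidable {L} bounded = do
    below ← ¬¬-decidableBelow L
    pure (decide below)
    where
    decide : (∀ ρ → ρ < L → Dec (P ρ)) → Decidable P
    decide below ρ with ρ <? L
    ... | yes ρ<L = below ρ ρ<L
    ... | no  ρ≮L = no (ρ≮L ∘ bounded)

¬¬-boundedWitnesses : (Q : ℕ → ℕ → Set) → ∀ L →
                      ¬ ¬ ∃ λ B → ∀ ρ → ρ < L → ∃ (Q ρ) → ∃ λ q → q ≤ B × Q ρ q
¬¬-boundedWitnesses Q zero    = pure (0 , λ _ ())
¬¬-boundedWitnesses Q (suc L) = do
  B , below ← ¬¬-boundedWitnesses Q L
  found? ← ¬¬-excluded-middle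
  pure (extend B below found?)
  where
  extend : ∀ B → (∀ ρ → ρ < L → ∃ (Q ρ) → ∃ λ q → q ≤ B × Q ρ q) → Dec (∃ (Q L)) →
           ∃ λ B′ → ∀ ρ → ρ < suc L → ∃ (Q ρ) → ∃ λ q → q ≤ B′ × Q ρ q
  extend B below (yes (q , Qq)) = B + q , λ ρ ρ<1+L Qρ → case m≤n⇒m<n∨m≡n (≤-pred ρ<1+L) of λ where
    (inj₁ ρ<L) → let q′ , q′≤B , Qq′ = below ρ ρ<L Qρ in q′ , ≤-trans q′≤B (m≤m+n B q) , Qq′
    (inj₂ refl) → q , m≤n+m q B , Qq
  extend B below (no ¬Q) = B , λ ρ ρ<1+L Qρ → case m≤n⇒m<n∨m≡n (≤-pred ρ<1+L) of λ where
    (inj₁ ρ<L) → below ρ ρ<L Qρ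
    (inj₂ refl) → contradiction Qρ ¬Q

countBelow : {P : ℕ → Set} → Decidable P → ℕ → ℕ
countBelow P? zero    = 0
countBelow P? (suc L) with P? L
... | yes _ = suc (countBelow P? L)
... | no  _ = countBelow P? L

module _ {P Q : ℕ → Set} (P? : Decidable P) (Q? : Decidable Q) where

  countBelow-mono : ∀ L → (∀ {ρ} → ρ < L → Q ρ → P ρ) → countBelow Q? L ≤ countBelow P? L
  countBelow-mono zero    Q⇒P = z≤n
  countBelow-mono (suc L) Q⇒P with P? L | Q? L
  ... | yes _ | yes _ = s≤s (countBelow-mono L (Q⇒P ∘ m<n⇒m<1+n))
  ... | yes _ | no  _ = m≤n⇒m≤1+n (countBelow-mono L (Q⇒P ∘ m<n⇒m<1+n))
  ... | no ¬P | yes Q = contradiction (Q⇒P ≤-refl Q) ¬P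
  ... | no  _ | no  _ = countBelow-mono L (Q⇒P ∘ m<n⇒m<1+n)

  countBelow-< : ∀ L → (∀ {ρ} → ρ < L → Q ρ → P ρ) → ∀ {ρ} → ρ < L → P ρ → ¬ Q ρ →
                 countBelow Q? L < countBelow P? L
  countBelow-< (suc L) Q⇒P {ρ} ρ<1+L Pρ ¬Qρ with m≤n⇒m<n∨m≡n (≤-pred ρ<1+L) | P? L | Q? L
  ... | inj₁ ρ<L  | yes _ | yes _ = s≤s (countBelow-< L (Q⇒P ∘ m<n⇒m<1+n) ρ<L Pρ ¬Qρ)
  ... | inj₁ ρ<L  | yes _ | no  _ = m<n⇒m<1+n (countBelow-< L (Q⇒P ∘ m<n⇒m<1+n) ρ<L Pρ ¬Qρ)
  ... | _         | no ¬P | yes Q = contradiction (Q⇒P ≤-refl Q) ¬P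
  ... | inj₁ ρ<L  | no  _ | no  _ = countBelow-< L (Q⇒P ∘ m<n⇒m<1+n) ρ<L Pρ ¬Qρ
  ... | inj₂ refl | yes _ | yes Q = contradiction Q ¬Qρ
  ... | inj₂ refl | yes _ | no  _ = s≤s (countBelow-mono L (Q⇒P ∘ m<n⇒m<1+n))
  ... | inj₂ refl | no ¬P | no  _ = contradiction Pρ ¬P

module _ {S : ℕ → ℕ → Set} (antitone : ∀ {V W} → V ≤ W → ∀ {ρ} → S W ρ → S V ρ)
         {L : ℕ} (bounded : ∀ {V ρ} → S V ρ → ρ < L)
         {Admissible : ℕ → ℕ → Set} (admissible : ∀ V → ¬ ¬ ∃ (Admissible V)) where

  Stable : ℕ → ℕ → Set
  Stable V₀ V = V₀ ≤ V × ∃ λ B → Admissible V B × (∀ {ρ} → S V ρ → S (V + B) ρ)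

  -- Each failure of stability strictly shrinks the finite set S V.
  ¬¬-stable : ∀ V₀ → ¬ ¬ ∃ (Stable V₀)
  ¬¬-stable V₀ = do
    S? ← ¬¬-decidable bounded
    descend _ V₀ ≤-refl S? ≤-refl
    where
    descend : ∀ c V → V₀ ≤ V → (S? : Decidable (S V)) → countBelow S? L < c → ¬ ¬ ∃ (Stable V₀)
    descend (suc c) V V₀≤V S? count<1+c = do
      B , admissible-B ← admissible V
      S′? ← ¬¬-decidable bounded
      lost? ← ¬¬-excluded-middle
      case lost? of λ where
        (no nothing-lost) → pure (V , V₀≤V , B , admissible-B , λ {ρ} Sρ → case S′? ρ of λ where
          (yes S′ρ) → S′ρ
          (no ¬S′ρ) → contradiction (ρ , Sρ , ¬S′ρ) nothing-lost)
        (yes (ρ , Sρ , ¬S′ρ)) → descend c (V + B) (≤-trans V₀≤V (m≤m+n V B)) S′?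
          (<-≤-trans (countBelow-< S? S′? L (λ _ → antitone (m≤m+n V B)) (bounded Sρ) Sρ ¬S′ρ) (≤-pred count<1+c))

-- Aligned recurrence of prefixes in almost periodic words

RecursAligned : (ℕ → A) → (L U G : ℕ) → Set
RecursAligned y L U G = ∀ j → ∃ λ t → j ≤ t * L × t * L ≤ j + G × slice y (t * L) U ≡ slice y 0 U

module AlignedRecurrence {y : ℕ → B} (almostPeriodic : AlmostPeriodic y) (L : ℕ) .{{_ : NonZero L}} where

  PrefixAt : ℕ → ℕ → Set
  PrefixAt V q = slice y q V ≡ slice y 0 V

  PrefixAt-antitone : ∀ {V W q} → V ≤ W → PrefixAt W q → PrefixAt V q
  PrefixAt-antitone {V} {W} V≤W eq = slice-≡ V λ d d<V → slice-≡⁻ W eq d (<-≤-trans d<V V≤W)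

  PrefixAt-+ : ∀ {V W q q′} → PrefixAt W q → PrefixAt V q′ → q′ + V ≤ W → PrefixAt V (q + q′)
  PrefixAt-+ {V} {W} {q} {q′} eq eq′ q′+V≤W = trans
    (slice-≡ V λ d d<V → trans (cong y (+-assoc q q′ d))
                              (slice-≡⁻ W eq (q′ + d) (<-≤-trans (+-monoʳ-< q′ d<V) q′+V≤W)))
    eq′

  Residue : ℕ → ℕ → Set
  Residue V ρ = ∃ λ q → q % L ≡ ρ × PrefixAt V q

  Residue-antitone : ∀ {V W} → V ≤ W → ∀ {ρ} → Residue W ρ → Residue V ρ
  Residue-antitone V≤W (q , q≡ρ , eq) = q , q≡ρ , PrefixAt-antitone V≤W eq

  Residue-bounded : ∀ {V ρ} → Residue V ρ → ρ < L
  Residue-bounded (q , refl , _) = m%n<n q L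

  Witnessed : ℕ → ℕ → Set
  Witnessed V B = ∀ ρ → ρ < L → Residue V ρ → ∃ λ q → q ≤ B × (q % L ≡ ρ × PrefixAt V q)

  %-cong-+ : ∀ {a a′ b b′} → a % L ≡ a′ % L → b % L ≡ b′ % L → (a + b) % L ≡ (a′ + b′) % L
  %-cong-+ {a} {a′} {b} {b′} a≡ b≡ =
    trans (%-distribˡ-+ a b L) (trans (cong₂ (λ u v → (u + v) % L) a≡ b≡) (sym (%-distribˡ-+ a′ b′ L)))

  -- Once the residues of prefix occurrences are stable, they form a subgroup of ℤ/L.
  module _ {V B : ℕ} (witnessed : Witnessed V B) (stable : ∀ {ρ} → Residue V ρ → Residue (V + B) ρ) where

    Residue-+ : ∀ {a b} → Residue V (a % L) → Residue V (b % L) → Residue V ((a + b) % L)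
    Residue-+ {a} {b} Ra Rb with stable Ra | witnessed (b % L) (m%n<n b L) Rb
    ... | q₁ , q₁≡a , eq₁ | q₂ , q₂≤B , q₂≡b , eq₂ =
      q₁ + q₂ , %-cong-+ q₁≡a q₂≡b ,
      PrefixAt-+ eq₁ eq₂ (≤-trans (≤-reflexive (+-comm q₂ V)) (+-monoʳ-≤ V q₂≤B))

    Residue-* : ∀ {a} → Residue V (a % L) → ∀ m → Residue V ((m * a) % L)
    Residue-* Ra zero    = 0 , refl , refl
    Residue-* Ra (suc m) = Residue-+ Ra (Residue-* Ra m)

    -- The residue of q is inverted by that of (L - 1) q.
    alignedNear : ∀ {q} → PrefixAt (V + B) q → ∃ λ t → q ≤ t * L × t * L ≤ q + B × PrefixAt V (t * L)
    alignedNear {q} eq with witnessed _ (m%n<n _ L) (Residue-* (Residue-antitone (m≤m+n V B) (q , refl , eq)) (L ∸ 1))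
    ... | q₂ , q₂≤B , q₂≡-q , eq₂ = p / L , subst (q ≤_) p≡tL (m≤m+n q q₂) ,
                                   subst (_≤ q + B) p≡tL (+-monoʳ-≤ q q₂≤B) ,
                                   subst (PrefixAt V) p≡tL (PrefixAt-+ eq eq₂ q₂+V≤V+B)
      where
      p = q + q₂
      q₂+V≤V+B : q₂ + V ≤ V + B
      q₂+V≤V+B = ≤-trans (≤-reflexive (+-comm q₂ V)) (+-monoʳ-≤ V q₂≤B)
      p%L≡0 : p % L ≡ 0
      p%L≡0 = begin
        (q + q₂) % L                 ≡⟨ %-cong-+ refl q₂≡-q ⟩
        (q + (L ∸ 1) * q) % L        ≡⟨ cong (λ m → (m * q) % L) (suc-pred L) ⟩
        (L * q) % L                  ≡⟨ cong (_% L) (*-comm L q) ⟩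
        (q * L) % L                  ≡⟨ m*n%n≡0 q L ⟩
        0                            ∎
        where open ≡-Reasoning
      p≡tL : p ≡ p / L * L
      p≡tL = trans (m≡m%n+[m/n]*n p L) (cong (_+ p / L * L) p%L≡0)

    alignedGaps : ∃ (RecursAligned y L V)
    alignedGaps = l + B , aligned
      where
      W = V + B
      recurrence = almostPeriodic (slice y 0 W) (0 , sym (trans (cong (factor y 0) (length-slice y 0 W)) (factor≡slice y 0 W)))
      l = proj₁ recurrence
      aligned : RecursAligned y L V (l + B)
      aligned j with occursIn-slice y j l (subst (OccursIn _) (factor≡slice y j l) (proj₂ recurrence j))
      ... | d , d+W≤l , prefix≡
        with alignedNear (sym (subst (λ m → slice y 0 W ≡ slice y (j + d) m) (length-slice y 0 W) prefix≡))
      ... | t , j+d≤tL , tL≤j+d+B , eq = t , ≤-trans (m≤m+n j d) j+d≤tL , ≤-trans tL≤j+d+B j+d+B≤j+l+B , eq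
        where
        j+d+B≤j+l+B : j + d + B ≤ j + (l + B)
        j+d+B≤j+l+B = ≤-trans (+-monoˡ-≤ B (+-monoʳ-≤ j (≤-trans (m≤m+n d _) d+W≤l))) (≤-reflexive (+-assoc j l B))

  alignedRecurrence : ∀ U → ¬ ¬ ∃ (RecursAligned y L U)
  alignedRecurrence U = do
    V , U≤V , B , witnessed , stable ←
      ¬¬-stable Residue-antitone Residue-bounded (λ V → ¬¬-boundedWitnesses (λ ρ q → q % L ≡ ρ × PrefixAt V q) L) U
    let G , aligned = alignedGaps witnessed stable
    pure (G , λ j → let t , j≤tL , tL≤j+G , eq = aligned j in t , j≤tL , tL≤j+G , PrefixAt-antitone U≤V eq)

module _ {n k : ℕ} {φ : Morphism (Fin n)} (uniform : Uniform k φ) {s : Fin n} (prolongable : Prolongable φ s)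
         {x : ℕ → Fin n} (limit : IsFixedPointLimit φ s x) {B : Set} (_≟_ : DecidableEquality B) (h : Fin n → B) where

  open FixedPoint uniform prolongable limit

  coded-block : ∀ a t → map h (pow φ a (x t)) ≡ slice (h ∘ x) (t * k ^ a) (k ^ a)
  coded-block a t = trans (cong (map h) (block a t)) (map-slice h x _ _)

  coded-prefix : ∀ a → map h (pow φ a s) ≡ slice (h ∘ x) 0 (k ^ a)
  coded-prefix a = trans (cong (map h) (prefix a)) (map-slice h x _ _)

  Meets : ℕ → ℕ → Set
  Meets r m = ∀ b → ∃ λ c → (c ∈ pow φ m b) × Equiv φ h r c s

  Meets? : ∀ r m → Dec (Meets r m)
  Meets? r m = all? λ b → map′ find (λ (c , c∈ , c∼s) → lose c∈ c∼s)
                           (any? (λ c → ≡-dec _≟_ (map h (pow φ r c)) (map h (pow φ r s))) (pow φ m b))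

  meets⇒almostPeriodic : ∀ {r} → bell n ≤ r → ∃ (Meets r) → AlmostPeriodic (h ∘ x)
  meets⇒almostPeriodic {r} bell≤r (m₀ , meets) u (i , u≡) with Equiv-eventuallyPeriodic φ uniform _≟_ h
  ... | q , 0<q , periodic = K + K , window
    where
    V = length u
    M = r + q * (i + V)
    K = k ^ (M + m₀)
    instance
      K≢0 : NonZero K
      K≢0 = kᵐ≢0 (M + m₀)

    i+V≤kᴹ : i + V ≤ k ^ M
    i+V≤kᴹ = ≤-trans (m≤n*m (i + V) q {{>-nonZero 0<q}}) (≤-trans (m≤n+m (q * (i + V)) r) (<⇒≤ (m<k^m 2≤k M)))

    u-in-φᴹs : OccursIn u (map h (pow φ M s))
    u-in-φᴹs = subst₂ OccursIn (sym (trans u≡ (factor≡slice (h ∘ x) i V))) (sym (coded-prefix M))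
                 (slice-occursIn (h ∘ x) 0 (k ^ M) i V i+V≤kᴹ)

    window : ∀ j → OccursIn u (factor (h ∘ x) j (K + K))
    window j with multipleBetween K j
    ... | t , j≤tK , tK≤j+K with meets (x t) | m≤n⇒∃[o]m+o≡n j≤tK
    ... | c , c∈ , c∼s | d , j+d≡tK = subst (OccursIn u) (sym (factor≡slice (h ∘ x) j (K + K)))
      (occursIn-trans u-in-φᴹs (occursIn-trans φᴹs-in-block block-in-window))
      where
      φᴹs-in-block : OccursIn (map h (pow φ M s)) (map h (pow φ (M + m₀) (x t)))
      φᴹs-in-block = subst₂ OccursIn (proj₁ (periodic r bell≤r (i + V)) c∼s) (cong (map h) (sym (pow-+ φ M m₀ (x t))))
                       (occursIn-map h (occursIn-concatMap (pow φ M) c∈))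
      d+K≤K+K : d + K ≤ K + K
      d+K≤K+K = +-monoˡ-≤ K (+-cancelˡ-≤ j d K (subst (_≤ j + K) (sym j+d≡tK) tK≤j+K))
      block-in-window : OccursIn (map h (pow φ (M + m₀) (x t))) (slice (h ∘ x) j (K + K))
      block-in-window = subst₂ OccursIn (trans (cong (λ a → slice (h ∘ x) a K) j+d≡tK) (sym (coded-block (M + m₀) t))) refl
                          (slice-occursIn (h ∘ x) j (K + K) d K d+K≤K+K)

  recursAligned⇒Meets : (∀ a → ∃ λ i → x i ≡ a) → ∀ r G → RecursAligned (h ∘ x) (k ^ r) (k ^ r) G →
                        ∀ m → G < k ^ m → Meets r m
  recursAligned⇒Meets surjective r G aligned m G<K b with surjective b
  ... | i , refl with aligned (i * k ^ m * k ^ r)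
  ... | t , iKL≤tL , tL≤iKL+G , prefix≡ = x t , subst (λ u → x u ∈ pow φ m (x i)) iK+d≡t (∈-block m i d d<K) ,
        trans (coded-block r t) (trans prefix≡ (sym (coded-prefix r)))
    where
    K = k ^ m
    L = k ^ r
    instance
      L≢0 : NonZero L
      L≢0 = kᵐ≢0 r
    iK≤t : i * K ≤ t
    iK≤t = *-cancelʳ-≤ (i * K) t L iKL≤tL
    d = t ∸ i * K
    iK+d≡t : i * K + d ≡ t
    iK+d≡t = m+[n∸m]≡n iK≤t
    t<iK+K : t < i * K + K
    t<iK+K = *-cancelʳ-< L t (i * K + K) (begin-strict
      t * L              ≤⟨ tL≤iKL+G ⟩
      i * K * L + G      <⟨ +-monoʳ-< (i * K * L) (<-≤-trans G<K (m≤m*n K L)) ⟩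
      i * K * L + K * L  ≡⟨ sym (*-distribʳ-+ L (i * K) K) ⟩
      (i * K + K) * L    ∎)
      where open ≤-Reasoning
    d<K : d < K
    d<K = +-cancelˡ-< (i * K) d K (subst (_< i * K + K) (sym iK+d≡t) t<iK+K)

  almostPeriodic⇒meets : (∀ a → ∃ λ i → x i ≡ a) → ∀ r → AlmostPeriodic (h ∘ x) → ∃ (Meets r)
  almostPeriodic⇒meets surjective r ap with Contains-eventuallyPeriodic φ
  ... | q , 0<q , periodic = N₀ , decidable-stable (Meets? r N₀) (¬¬-map meets-N₀ (alignedRecurrence (k ^ r)))
    where
    instance
      L≢0 : NonZero (k ^ r)
      L≢0 = kᵐ≢0 r
    open AlignedRecurrence {y = h ∘ x} ap (k ^ r) using (alignedRecurrence)
    N₀ = (2 ^ n) ^ n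
    meets-N₀ : ∃ (RecursAligned (h ∘ x) (k ^ r) (k ^ r)) → Meets r N₀
    meets-N₀ (G , aligned) b =
      let c , c∈ , c∼s = recursAligned⇒Meets surjective r G aligned (N₀ + q * G) G<kᵐ b
      in  c , proj₂ (periodic N₀ ≤-refl G) c∈ , c∼s
      where
      G<kᵐ : G < k ^ (N₀ + q * G)
      G<kᵐ = ≤-<-trans (≤-trans (m≤n*m G q {{>-nonZero 0<q}}) (m≤n+m (q * G) N₀)) (m<k^m 2≤k (N₀ + q * G))

proposition5 : (n p k : ℕ) (φ : Morphism (Fin n)) (h : Fin n → Fin p) (s : Fin n)
    → Uniform k φ → Prolongable φ s
    → (x : ℕ → Fin n) → IsFixedPointLimit φ s x
    → (∀ a → ∃ λ i → x i ≡ a)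
    → (r : ℕ) → r ≥ bell n
    → (AlmostPeriodic (λ i → h (x i))
       ⇔ (∃ λ m → ∀ b → ∃ λ c → (c ∈ pow φ m b) × Equiv φ h r c s))
proposition5 n p k φ h s uniform prolongable x limit surjective r bell≤r =
  mk⇔ (almostPeriodic⇒meets uniform prolongable limit _≟ᶠ_ h surjective r)
      (meets⇒almostPeriodic uniform prolongable limit _≟ᶠ_ h bell≤r)
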